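{- Let $X$ be a graph with edge set $E$, $|E|=m$, let $\pi$ be a permutation of $E$, and let $\mathcal{B}$ be a cycle basis of $X$. Then $\pi\in \mathrm{Aut}(M_X)$ if and only if $\pi(\mathcal{B})$ is a cycle basis of $X$.
   Context: $M_X$ is the graphic matroid of $X$: ground set $E$, circuits the edge sets of simple cycles. $\mathrm{Aut}(M_X)$ is the group of permutations $\phi$ of $E$ such that for all $C\subseteq E$, $C$ is a circuit iff $\phi(C)$ is a circuit. Each cycle is identified with its edge set, viewed as a vector in $\mathbb{F}_2^{E}$. A cycle basis of $X$ is a minimal set $\mathcal{B}$ of cycles such that every cycle of $X$ is an $\mathbb{F}_2$-linear combination of cycles in $\mathcal{B}$; $\pi(\mathcal{B})$ is the set of images of its members under $\pi$. -}

module Defs where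

open import Data.Nat using (ℕ; zero; suc)
open import Data.Fin using (Fin; zero; suc; inject₁; fromℕ)
open import Data.Fin.Subset using (Subset; ⊥; _∈_)
open import Data.Fin.Permutation using (Permutation′; _⟨$⟩ˡ_)
open import Data.Bool using (Bool; _xor_)
open import Data.Vec using (Vec; zipWith; tabulate; lookup)
open import Data.List using (List; foldr)
open import Data.List.Relation.Unary.All using (All)
open import Data.Product using (Σ; ∃; _×_; _,_)
open import Data.Sum using (_⊎_)
open import Function.Definitions using (Injective)
open import Relation.Binary.PropositionalEquality using (_≡_)
open import Relation.Nullary using (¬_)
open import Level using (Level) renaming (suc to lsuc; zero to lzero)

-- A finite simple graph with vertex set Fin n and edge set E = Fin m.
-- Each edge has an (ordered representation of its) pair of endpoints;
-- no loops and no parallel edges.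
record Graph (n m : ℕ) : Set where
  field
    ends     : Fin m → Fin n × Fin n
    loopless : ∀ e u v → ends e ≡ (u , v) → ¬ (u ≡ v)
    noParallel : ∀ e f u v → ends e ≡ (u , v) →
                 (ends f ≡ (u , v) ⊎ ends f ≡ (v , u)) → e ≡ f

module _ {n m : ℕ} (X : Graph n m) where
  open Graph X

  Joins : Fin m → Fin n → Fin n → Set
  Joins e u v = ends e ≡ (u , v) ⊎ ends e ≡ (v , u)

  -- A simple cycle of length k = suc l: distinct vertices vs 0 .. vs l,
  -- (vs (suc l) = vs 0 closes it up), distinct edges es i joining
  -- vs i and vs (i+1).
  record SimpleCycle : Set where
    field
      l        : ℕ
      vs       : Fin (suc (suc l)) → Fin n
      es       : Fin (suc l) → Fin m
      closed   : vs (fromℕ (suc l)) ≡ vs zero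
      vs-inj   : Injective _≡_ _≡_ (λ (i : Fin (suc l)) → vs (inject₁ i))
      es-inj   : Injective _≡_ _≡_ es
      joins    : ∀ i → Joins (es i) (vs (inject₁ i)) (vs (suc i))

  EdgeSetOf : SimpleCycle → Subset m → Set
  EdgeSetOf Z C = ∀ e → (e ∈ C → ∃ λ i → SimpleCycle.es Z i ≡ e)
                      × ((∃ λ i → SimpleCycle.es Z i ≡ e) → e ∈ C)

  IsCircuit : Subset m → Set
  IsCircuit C = ∃ λ Z → EdgeSetOf Z C

-- image φ(C) of an edge set under a permutation of E: j ∈ φ(C) iff φ⁻¹ j ∈ C
image : {m : ℕ} → Permutation′ m → Subset m → Subset m
image π C = tabulate (λ j → lookup C (π ⟨$⟩ˡ j))

-- vector addition in F₂^E (symmetric difference)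
_⊕_ : {m : ℕ} → Subset m → Subset m → Subset m
_⊕_ = zipWith _xor_

sumF2 : {m : ℕ} → List (Subset m) → Subset m
sumF2 = foldr _⊕_ ⊥

Family : ℕ → Set₁
Family m = Subset m → Set

InSpan : {m : ℕ} → Family m → Subset m → Set
InSpan S x = ∃ λ L → All S L × sumF2 L ≡ x

imageFamily : {m : ℕ} → Permutation′ m → Family m → Family m
imageFamily π B D = ∃ λ C → B C × D ≡ image π C

module _ {n m : ℕ} (X : Graph n m) where

  SpansCycles : Family m → Set
  SpansCycles S = ∀ C → IsCircuit X C → InSpan S C

  -- π ∈ Aut(M_X): C circuit iff π(C) circuit
  InAut : Permutation′ m → Set
  InAut π = ∀ C → (IsCircuit X C → IsCircuit X (image π C))
                × (IsCircuit X (image π C) → IsCircuit X C)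

  IsCycleBasis : Family m → Set₁
  IsCycleBasis B =
      (∀ C → B C → IsCircuit X C)
    × SpansCycles B
    × (∀ (B' : Family m) → (∀ C → B' C → B C) → SpansCycles B' →
         ∀ C → B C → B' C)

module Submission where

-- A permutation π of the edge set acts linearly on F₂^E, so it carries the
-- span of a cycle basis B onto the span of π(B).  The proof rests on the
-- characterisation of circuits inside the cycle space of a graph:
--
--   * every circuit is an even edge set (each vertex has even degree in it),
--     hence so is every F₂-combination of circuits;
--   * a nonempty even subset of a circuit is the whole circuit;
--   * every nonempty even edge set contains a circuit (follow edges of the
--     set without immediately turning back until a vertex repeats).
--
-- From these, a permutation ρ such that ρ and ρ⁻¹ send circuits to even
-- sets sends circuits to circuits: ρ(C) contains a circuit D, and ρ⁻¹(D) is
-- a nonempty even subset of C, so ρ⁻¹(D) = C.  If π(B) is a cycle basis,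
-- both π and π⁻¹ send circuits into spans of circuits, so π ∈ Aut(M_X).
-- Conversely an automorphism transports circuits, spans and the minimality
-- of B, so π(B) is a cycle basis.

open import Defs
open import Data.Nat using (ℕ; zero; suc; _+_; _<_; _∸_; s≤s⁻¹)
import Data.Nat.Properties as NP
open import Data.Fin using (Fin; zero; suc; toℕ; inject₁; fromℕ; fromℕ<)
import Data.Fin.Properties as FP
open import Data.Fin.Subset using (Subset; ⊥)
open import Data.Fin.Permutation using (Permutation′; _⟨$⟩ˡ_; _⟨$⟩ʳ_; inverseˡ; flip)
open import Data.Bool using (Bool; true; false; _xor_; _∧_; not)
import Data.Bool.Properties as BP
open import Algebra.Bundles using (CommutativeRing)
open import Algebra.Properties.CommutativeSemigroup
  (CommutativeRing.+-commutativeSemigroup BP.xor-∧-commutativeRing) using (interchange)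
open import Data.Vec using (lookup; tabulate)
import Data.Vec.Properties as VP
open import Data.List using ([]; _∷_; map)
open import Data.List.Relation.Unary.All using (All; []; _∷_)
import Data.List.Relation.Unary.All as All
open import Data.Product using (Σ; ∃; _×_; _,_; proj₁; proj₂)
open import Data.Sum using (_⊎_; inj₁; inj₂)
open import Data.Empty using (⊥-elim)
open import Relation.Binary.PropositionalEquality
open import Relation.Binary using (tri<; tri≈; tri>)
open import Relation.Nullary using (¬_; Dec; yes; no; does)
open import Relation.Nullary.Decidable using (_⊎-dec_; _×-dec_; ¬?; dec-true; dec-false)

-- Bits and finite F₂-sums

dec-witness : ∀ {P : Set} (d : Dec P) → does d ≡ true → P
dec-witness (yes p) _ = p
dec-witness (no _) ()

∧-true : ∀ a b → a ∧ b ≡ true → a ≡ true × b ≡ true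
∧-true true true _ = refl , refl

xor-false⇒≡ : ∀ a b → a xor b ≡ false → a ≡ b
xor-false⇒≡ true true _ = refl
xor-false⇒≡ false false _ = refl

bool-antisym : ∀ {a b} → (a ≡ true → b ≡ true) → (b ≡ true → a ≡ true) → a ≡ b
bool-antisym {true} f g = sym (f refl)
bool-antisym {false} {true} f g = g refl
bool-antisym {false} {false} f g = refl

split-by : ∀ x d → x ≡ (x ∧ d) xor (x ∧ not d)
split-by x d = begin
  x                         ≡⟨ sym (BP.∧-identityʳ x) ⟩
  x ∧ true                  ≡⟨ cong (x ∧_) (sym (BP.xor-inverseʳ d)) ⟩
  x ∧ (d xor not d)         ≡⟨ BP.∧-distribˡ-xor x d (not d) ⟩
  (x ∧ d) xor (x ∧ not d)   ∎
  where open ≡-Reasoning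

parity : ∀ {k} → (Fin k → Bool) → Bool
parity {zero} f = false
parity {suc k} f = f zero xor parity (λ i → f (suc i))

parity-cong : ∀ {k} {f h : Fin k → Bool} → (∀ i → f i ≡ h i) → parity f ≡ parity h
parity-cong {zero} p = refl
parity-cong {suc k} p = cong₂ _xor_ (p zero) (parity-cong (λ i → p (suc i)))

parity-zero : ∀ {k} (f : Fin k → Bool) → (∀ i → f i ≡ false) → parity f ≡ false
parity-zero {zero} f p = refl
parity-zero {suc k} f p rewrite p zero = parity-zero (λ i → f (suc i)) (λ i → p (suc i))

parity-single : ∀ {k} (f : Fin k → Bool) (a : Fin k) →
                (∀ i → i ≢ a → f i ≡ false) → parity f ≡ f a
parity-single {suc k} f zero p
  rewrite parity-zero (λ i → f (suc i)) (λ i → p (suc i) (λ ())) = BP.xor-identityʳ (f zero)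
parity-single {suc k} f (suc a) p rewrite p zero (λ ()) =
  parity-single (λ i → f (suc i)) a (λ i i≢a → p (suc i) (λ eq → i≢a (FP.suc-injective eq)))

parity-xor : ∀ {k} (f h : Fin k → Bool) →
             parity (λ i → f i xor h i) ≡ parity f xor parity h
parity-xor {zero} f h = refl
parity-xor {suc k} f h rewrite parity-xor (λ i → f (suc i)) (λ i → h (suc i)) =
  interchange (f zero) (h zero) (parity (λ i → f (suc i))) (parity (λ i → h (suc i)))

parity-pair : ∀ {k} (f : Fin k → Bool) (a b : Fin k) → a ≢ b →
              (∀ i → i ≢ a → i ≢ b → f i ≡ false) → parity f ≡ f a xor f b
parity-pair f a b a≢b p = begin
    parity f                    ≡⟨ parity-cong (λ i → split-by (f i) (atA i)) ⟩
    parity (λ i → onA i xor offA i) ≡⟨ parity-xor onA offA ⟩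
    parity onA xor parity offA
      ≡⟨ cong₂ _xor_ (parity-single onA a onA-a) (parity-single offA b offA-b) ⟩
    onA a xor offA b            ≡⟨ cong₂ _xor_ onA-at-a offA-at-b ⟩
    f a xor f b                 ∎
  where
  open ≡-Reasoning
  atA : Fin _ → Bool
  atA i = does (i FP.≟ a)
  onA offA : Fin _ → Bool
  onA i = f i ∧ atA i
  offA i = f i ∧ not (atA i)
  onA-a : ∀ i → i ≢ a → onA i ≡ false
  onA-a i i≢a rewrite dec-false (i FP.≟ a) i≢a = BP.∧-zeroʳ (f i)
  offA-b : ∀ i → i ≢ b → offA i ≡ false
  offA-b i i≢b with i FP.≟ a
  ... | yes _ = BP.∧-zeroʳ (f i)
  ... | no i≢a rewrite p i i≢a i≢b = refl
  onA-at-a : onA a ≡ f a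
  onA-at-a rewrite dec-true (a FP.≟ a) refl = BP.∧-identityʳ (f a)
  offA-at-b : offA b ≡ f b
  offA-at-b rewrite dec-false (b FP.≟ a) (λ b≡a → a≢b (sym b≡a)) = BP.∧-identityʳ (f b)

parity-other-one : ∀ {k} (f : Fin k → Bool) (a : Fin k) → parity f ≡ false → f a ≡ true →
                   ∃ λ b → b ≢ a × f b ≡ true
parity-other-one f a sum0 fa with FP.any? (λ b → ¬? (b FP.≟ a) ×-dec (f b BP.≟ true))
... | yes other = other
... | no none = ⊥-elim (false≢true (trans (sym sum0) (trans (parity-single f a only-a) fa)))
  where
  false≢true : false ≢ true
  false≢true ()
  only-a : ∀ i → i ≢ a → f i ≡ false
  only-a i i≢a with f i in eq
  ... | false = refl
  ... | true = ⊥-elim (none (i , i≢a , eq))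

-- Edge sets and the action of permutations on them

_⊑_ : ∀ {m} → Subset m → Subset m → Set
D ⊑ C = ∀ e → lookup D e ≡ true → lookup C e ≡ true

subset-ext : ∀ {m} {x y : Subset m} → (∀ e → lookup x e ≡ lookup y e) → x ≡ y
subset-ext {x = x} {y} h =
  trans (sym (VP.tabulate∘lookup x)) (trans (VP.tabulate-cong h) (VP.tabulate∘lookup y))

⊑-antisym : ∀ {m} {x y : Subset m} → x ⊑ y → y ⊑ x → x ≡ y
⊑-antisym x⊑y y⊑x = subset-ext (λ e → bool-antisym (x⊑y e) (y⊑x e))

lookup-⊥ : ∀ {m} (e : Fin m) → lookup (⊥ {m}) e ≡ false
lookup-⊥ e = VP.lookup-replicate e false

lookup-⊕ : ∀ {m} (x y : Subset m) e → lookup (x ⊕ y) e ≡ lookup x e xor lookup y e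
lookup-⊕ x y e = VP.lookup-zipWith _xor_ e x y

lookup-image : ∀ {m} (π : Permutation′ m) C j → lookup (image π C) j ≡ lookup C (π ⟨$⟩ˡ j)
lookup-image π C j = VP.lookup∘tabulate _ j

lookup-image-at : ∀ {m} (π : Permutation′ m) C e → lookup (image π C) (π ⟨$⟩ʳ e) ≡ lookup C e
lookup-image-at π C e = trans (lookup-image π C _) (cong (lookup C) (inverseˡ π))

image-mono : ∀ {m} (π : Permutation′ m) {C D} → C ⊑ D → image π C ⊑ image π D
image-mono π {C} {D} C⊑D j j∈πC =
  trans (lookup-image π D j) (C⊑D _ (trans (sym (lookup-image π C j)) j∈πC))

image-flip-image : ∀ {m} (π : Permutation′ m) C → image (flip π) (image π C) ≡ C
image-flip-image π C = subset-ext λ j →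
  trans (lookup-image (flip π) (image π C) j) (lookup-image-at π C j)

image-image-flip : ∀ {m} (π : Permutation′ m) C → image π (image (flip π) C) ≡ C
image-image-flip π C = image-flip-image (flip π) C

image-⊕ : ∀ {m} (π : Permutation′ m) x y → image π (x ⊕ y) ≡ image π x ⊕ image π y
image-⊕ π x y = subset-ext λ j → begin
    lookup (image π (x ⊕ y)) j                   ≡⟨ lookup-image π (x ⊕ y) j ⟩
    lookup (x ⊕ y) (π ⟨$⟩ˡ j)                    ≡⟨ lookup-⊕ x y (π ⟨$⟩ˡ j) ⟩
    lookup x (π ⟨$⟩ˡ j) xor lookup y (π ⟨$⟩ˡ j)
      ≡⟨ sym (cong₂ _xor_ (lookup-image π x j) (lookup-image π y j)) ⟩
    lookup (image π x) j xor lookup (image π y) j ≡⟨ sym (lookup-⊕ (image π x) (image π y) j) ⟩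
    lookup (image π x ⊕ image π y) j             ∎
  where open ≡-Reasoning

image-⊥ : ∀ {m} (π : Permutation′ m) → image π ⊥ ≡ ⊥
image-⊥ {m} π = subset-ext λ j →
  trans (lookup-image π ⊥ j) (trans (lookup-⊥ {m} (π ⟨$⟩ˡ j)) (sym (lookup-⊥ j)))

image-sumF2 : ∀ {m} (π : Permutation′ m) L → image π (sumF2 L) ≡ sumF2 (map (image π) L)
image-sumF2 π [] = image-⊥ π
image-sumF2 π (x ∷ L) = trans (image-⊕ π x (sumF2 L)) (cong (image π x ⊕_) (image-sumF2 π L))

image-span : ∀ {m} (π : Permutation′ m) {A A' : Family m} →
             (∀ a → A a → A' (image π a)) → ∀ x → InSpan A x → InSpan A' (image π x)
image-span π {A} {A'} A→A' x (L , L⊆A , ΣL≡x) =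
  map (image π) L , image-all L L⊆A , trans (sym (image-sumF2 π L)) (cong (image π) ΣL≡x)
  where
  image-all : ∀ L → All A L → All A' (map (image π) L)
  image-all [] [] = []
  image-all (a ∷ L) (Aa ∷ L⊆A) = A→A' a Aa ∷ image-all L L⊆A

image-member : ∀ {m} (π : Permutation′ m) (B : Family m) C → B C → imageFamily π B (image π C)
image-member π B C BC = C , BC , refl

preimage-member : ∀ {m} (π : Permutation′ m) (B : Family m) D →
                  imageFamily π B D → B (image (flip π) D)
preimage-member π B D (C , BC , refl) = subst B (sym (image-flip-image π C)) BC

fin-constant : ∀ {l} (f : Fin (suc l) → Bool) →
               (∀ (i : Fin l) → f (suc i) ≡ f (inject₁ i)) → ∀ i → f i ≡ f zero
fin-constant {zero} f p zero = refl
fin-constant {suc l} f p zero = refl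
fin-constant {suc l} f p (suc i) =
  trans (p i) (fin-constant (λ k → f (inject₁ k)) (λ k → p (inject₁ k)) i)

last-or-inject₁ : ∀ {k} (j : Fin (suc k)) → j ≡ fromℕ k ⊎ Σ (Fin k) λ j' → j ≡ inject₁ j'
last-or-inject₁ {zero} zero = inj₁ refl
last-or-inject₁ {suc k} zero = inj₂ (zero , refl)
last-or-inject₁ {suc k} (suc j) with last-or-inject₁ j
... | inj₁ eq = inj₁ (cong suc eq)
... | inj₂ (j' , eq) = inj₂ (suc j' , cong suc eq)

-- Even edge sets of a graph and circuits

module CycleSpace {n m : ℕ} (X : Graph n m) where
  open Graph X

  Inc : Fin m → Fin n → Set
  Inc e v = proj₁ (ends e) ≡ v ⊎ proj₂ (ends e) ≡ v

  inc? : ∀ e v → Dec (Inc e v)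
  inc? e v = (proj₁ (ends e) FP.≟ v) ⊎-dec (proj₂ (ends e) FP.≟ v)

  incident : Fin m → Fin n → Bool
  incident e v = does (inc? e v)

  degreeParity : Subset m → Fin n → Bool
  degreeParity D v = parity (λ e → lookup D e ∧ incident e v)

  Even : Subset m → Set
  Even D = ∀ v → degreeParity D v ≡ false

  joins⇒inc₁ : ∀ {e u v} → Joins X e u v → Inc e u
  joins⇒inc₁ (inj₁ eq) = inj₁ (cong proj₁ eq)
  joins⇒inc₁ (inj₂ eq) = inj₂ (cong proj₂ eq)

  joins⇒inc₂ : ∀ {e u v} → Joins X e u v → Inc e v
  joins⇒inc₂ (inj₁ eq) = inj₂ (cong proj₂ eq)
  joins⇒inc₂ (inj₂ eq) = inj₁ (cong proj₁ eq)

  inc-endpoint : ∀ {e u v w} → Joins X e u v → Inc e w → w ≡ u ⊎ w ≡ v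
  inc-endpoint (inj₁ eq) (inj₁ p) = inj₁ (trans (sym p) (cong proj₁ eq))
  inc-endpoint (inj₁ eq) (inj₂ p) = inj₂ (trans (sym p) (cong proj₂ eq))
  inc-endpoint (inj₂ eq) (inj₁ p) = inj₂ (trans (sym p) (cong proj₁ eq))
  inc-endpoint (inj₂ eq) (inj₂ p) = inj₁ (trans (sym p) (cong proj₂ eq))

  inc⇒joins : ∀ {e v} → Inc e v → ∃ λ v' → Joins X e v v'
  inc⇒joins {e} (inj₁ p) = proj₂ (ends e) , inj₁ (cong (λ z → z , proj₂ (ends e)) p)
  inc⇒joins {e} (inj₂ p) = proj₁ (ends e) , inj₂ (cong (λ z → proj₁ (ends e) , z) p)

  joins-unique : ∀ {e x x' y y'} → Joins X e x x' → Joins X e y y' → x ≡ y ⊎ (x ≡ y' × x' ≡ y)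
  joins-unique (inj₁ e1) (inj₁ e2) = inj₁ (cong proj₁ (trans (sym e1) e2))
  joins-unique (inj₁ e1) (inj₂ e2) =
    inj₂ (cong proj₁ (trans (sym e1) e2) , cong proj₂ (trans (sym e1) e2))
  joins-unique (inj₂ e1) (inj₁ e2) =
    inj₂ (cong proj₂ (trans (sym e1) e2) , cong proj₁ (trans (sym e1) e2))
  joins-unique (inj₂ e1) (inj₂ e2) = inj₁ (cong proj₂ (trans (sym e1) e2))

  degreeParity-⊥ : ∀ v → degreeParity ⊥ v ≡ false
  degreeParity-⊥ v = parity-zero _ (λ e → cong (_∧ incident e v) (lookup-⊥ e))

  degreeParity-⊕ : ∀ x y v → degreeParity (x ⊕ y) v ≡ degreeParity x v xor degreeParity y v
  degreeParity-⊕ x y v =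
    trans (parity-cong (λ e → trans (cong (_∧ incident e v) (lookup-⊕ x y e))
                                    (BP.∧-distribʳ-xor (incident e v) (lookup x e) (lookup y e))))
          (parity-xor (λ e → lookup x e ∧ incident e v) (λ e → lookup y e ∧ incident e v))

  -- Local structure of a simple cycle: vertex V i lies on the edges es i and
  -- es (prev i) and on no other edge of the cycle.
  module OnCycle (Z : SimpleCycle X) where
    open SimpleCycle Z

    V : Fin (suc l) → Fin n
    V i = vs (inject₁ i)

    prev : Fin (suc l) → Fin (suc l)
    prev zero = fromℕ l
    prev (suc i) = inject₁ i

    next-vertex : ∀ j → ∃ λ k → vs (suc j) ≡ V k
    next-vertex j with last-or-inject₁ j
    ... | inj₁ refl = zero , closed
    ... | inj₂ (j' , refl) = suc j' , refl

    inc-cycle-edge : ∀ i j → Inc (es j) (V i) → j ≡ i ⊎ j ≡ prev i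
    inc-cycle-edge i j q with inc-endpoint (joins j) q
    ... | inj₁ eq = inj₁ (sym (vs-inj eq))
    ... | inj₂ eq with last-or-inject₁ j
    ...   | inj₁ refl with vs-inj (trans eq closed)
    ...     | refl = inj₂ refl
    inc-cycle-edge i j q | inj₂ eq | inj₂ (j' , refl) with vs-inj eq
    ...     | refl = inj₂ refl

    inc-on-cycle : ∀ v j → Inc (es j) v → ∃ λ k → v ≡ V k
    inc-on-cycle v j q with inc-endpoint (joins j) q
    ... | inj₁ eq = j , eq
    ... | inj₂ eq = proj₁ (next-vertex j) , trans eq (proj₂ (next-vertex j))

    inc-prev : ∀ i → Inc (es (prev i)) (V i)
    inc-prev zero = subst (Inc (es (fromℕ l))) closed (joins⇒inc₂ (joins (fromℕ l)))
    inc-prev (suc i) = joins⇒inc₂ (joins (inject₁ i))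

    -- A loopless cycle has at least two edges.
    two-edges : l ≢ 0
    two-edges refl with joins zero
    ... | inj₁ eq = loopless (es zero) _ _ eq (sym closed)
    ... | inj₂ eq = loopless (es zero) _ _ eq closed

    prev≢ : ∀ i → prev i ≢ i
    prev≢ zero eq = two-edges (trans (sym (FP.toℕ-fromℕ l)) (cong toℕ eq))
    prev≢ (suc i) eq = NP.1+n≢n (sym (trans (sym (FP.toℕ-inject₁ i)) (cong toℕ eq)))

    module _ (C : Subset m) (C-edges : EdgeSetOf X Z C) where
      edge∈C : ∀ i → lookup C (es i) ≡ true
      edge∈C i = VP.[]=⇒lookup (proj₂ (C-edges (es i)) (i , refl))

      C-edge : ∀ e → lookup C e ≡ true → ∃ λ i → es i ≡ e
      C-edge e q = proj₁ (C-edges e) (VP.lookup⇒[]= e C q)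

      degreeParity-on-cycle : ∀ D → D ⊑ C → ∀ i →
                              degreeParity D (V i) ≡ lookup D (es i) xor lookup D (es (prev i))
      degreeParity-on-cycle D D⊑C i =
        trans (parity-pair f (es i) (es (prev i)) (λ eq → prev≢ i (sym (es-inj eq))) off-cycle)
              (cong₂ _xor_ (at (es i) (joins⇒inc₁ (joins i))) (at (es (prev i)) (inc-prev i)))
        where
        f : Fin m → Bool
        f e = lookup D e ∧ incident e (V i)
        at : ∀ e → Inc e (V i) → f e ≡ lookup D e
        at e q = trans (cong (lookup D e ∧_) (dec-true (inc? e (V i)) q)) (BP.∧-identityʳ _)
        off-cycle : ∀ e → e ≢ es i → e ≢ es (prev i) → f e ≡ false
        off-cycle e ≢this ≢prev with lookup D e in e∈D | incident e (V i) in inc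
        ... | false | _ = refl
        ... | true | false = refl
        ... | true | true with C-edge e (D⊑C e e∈D)
        ...   | (j , refl) with inc-cycle-edge i j (dec-witness (inc? _ _) inc)
        ...     | inj₁ refl = ⊥-elim (≢this refl)
        ...     | inj₂ refl = ⊥-elim (≢prev refl)

      cycle-even : Even C
      cycle-even v with FP.any? (λ i → V i FP.≟ v)
      ... | yes (i , refl) = trans (degreeParity-on-cycle C (λ _ q → q) i)
                                   (cong₂ _xor_ (edge∈C i) (edge∈C (prev i)))
      ... | no off = parity-zero _ no-edge
        where
        no-edge : ∀ e → lookup C e ∧ incident e v ≡ false
        no-edge e with lookup C e in e∈C | incident e v in inc
        ... | false | _ = refl
        ... | true | false = refl
        ... | true | true with C-edge e e∈C
        ...   | (j , refl) with inc-on-cycle v j (dec-witness (inc? _ _) inc)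
        ...     | (k , eq) = ⊥-elim (off (k , sym eq))

      -- An even D ⊆ C is constant along the cycle, so if it meets C it is C.
      cycle-minimal : ∀ D → Even D → D ⊑ C → ∀ e → lookup D e ≡ true → C ⊑ D
      cycle-minimal D even D⊑C e₀ e₀∈D e e∈C with C-edge e e∈C | C-edge e₀ (D⊑C e₀ e₀∈D)
      ... | (j , refl) | (k , refl) =
        trans (fin-constant f step j) (trans (sym (fin-constant f step k)) e₀∈D)
        where
        f : Fin (suc l) → Bool
        f i = lookup D (es i)
        step : ∀ (i : Fin l) → f (suc i) ≡ f (inject₁ i)
        step i = xor-false⇒≡ _ _
          (trans (sym (degreeParity-on-cycle D D⊑C (suc i))) (even (V (suc i))))

  circuit-even : ∀ C → IsCircuit X C → Even C
  circuit-even C (Z , C-edges) = OnCycle.cycle-even Z C C-edges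

  circuit-nonempty : ∀ C → IsCircuit X C → ∃ λ e → lookup C e ≡ true
  circuit-nonempty C (Z , C-edges) = SimpleCycle.es Z zero , OnCycle.edge∈C Z C C-edges zero

  circuit-minimal : ∀ C D → IsCircuit X C → Even D → D ⊑ C → ∀ e → lookup D e ≡ true → C ⊑ D
  circuit-minimal C D (Z , C-edges) = OnCycle.cycle-minimal Z C C-edges D

  span-even : (F : Family m) → (∀ C → F C → IsCircuit X C) → ∀ x → InSpan F x → Even x
  span-even F F-circuits x (L , L⊆F , refl) = sum-even L (All.map (λ {C} → F-circuits C) L⊆F)
    where
    sum-even : ∀ L → All (IsCircuit X) L → Even (sumF2 L)
    sum-even [] [] = degreeParity-⊥
    sum-even (C ∷ L) (cC ∷ cL) v =
      trans (degreeParity-⊕ C (sumF2 L) v) (cong₂ _xor_ (circuit-even C cC v) (sum-even L cL v))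

  segment-circuit : (D : Subset m) (w : ℕ → Fin n) (g : ℕ → Fin m) →
                    (∀ k → Joins X (g k) (w k) (w (suc k))) → (∀ k → g (suc k) ≢ g k) →
                    (∀ k → lookup D (g k) ≡ true) → (i₀ l : ℕ) → w (i₀ + suc l) ≡ w i₀ →
                    (∀ a b → a < i₀ + suc l → b < i₀ + suc l → w a ≡ w b → a ≡ b) →
                    ∃ λ C → IsCircuit X C × C ⊑ D
  segment-circuit D w g walk no-backtrack g∈D i₀ l closes w-distinct =
    C , (Z , C-edges) , C⊑D
    where
    end : ℕ
    end = i₀ + suc l
    in-segment : ∀ (t : Fin (suc l)) → i₀ + toℕ t < end
    in-segment t = NP.+-monoʳ-< i₀ (FP.toℕ<n t)
    -- Equal edges join equal vertex pairs; reversed pairs would force a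
    -- repeated vertex or an immediate backtrack.
    g-distinct : ∀ a b → a < end → b < end → g a ≡ g b → a ≡ b
    g-distinct a b a<end b<end ga≡gb
      with joins-unique (walk a) (subst (λ e → Joins X e (w b) (w (suc b))) (sym ga≡gb) (walk b))
    ... | inj₁ wa≡wb = w-distinct a b a<end b<end wa≡wb
    ... | inj₂ (wa≡wb' , wa'≡wb) with NP.<-cmp a b
    ...   | tri< a<b _ _ = ⊥-elim (no-backtrack a (trans
            (cong g (w-distinct (suc a) b (NP.≤-<-trans a<b b<end) b<end wa'≡wb)) (sym ga≡gb)))
    ...   | tri≈ _ a≡b _ = a≡b
    ...   | tri> _ _ b<a = ⊥-elim (no-backtrack b (trans
            (cong g (sym (w-distinct a (suc b) a<end (NP.≤-<-trans b<a a<end) wa≡wb'))) ga≡gb))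
    vs' : Fin (suc (suc l)) → Fin n
    vs' t = w (i₀ + toℕ t)
    es' : Fin (suc l) → Fin m
    es' t = g (i₀ + toℕ t)
    closed' : vs' (fromℕ (suc l)) ≡ vs' zero
    closed' rewrite FP.toℕ-fromℕ (suc l) | NP.+-identityʳ i₀ = closes
    vs-inj' : ∀ {s t} → vs' (inject₁ s) ≡ vs' (inject₁ t) → s ≡ t
    vs-inj' {s} {t} eq = FP.toℕ-injective (NP.+-cancelˡ-≡ i₀ _ _
      (w-distinct _ _ (in-segment s) (in-segment t)
        (subst₂ (λ x y → w (i₀ + x) ≡ w (i₀ + y)) (FP.toℕ-inject₁ s) (FP.toℕ-inject₁ t) eq)))
    es-inj' : ∀ {s t} → es' s ≡ es' t → s ≡ t
    es-inj' {s} {t} eq =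
      FP.toℕ-injective (NP.+-cancelˡ-≡ i₀ _ _ (g-distinct _ _ (in-segment s) (in-segment t) eq))
    joins' : ∀ t → Joins X (es' t) (vs' (inject₁ t)) (vs' (suc t))
    joins' t = subst₂ (Joins X (es' t)) (cong (λ z → w (i₀ + z)) (sym (FP.toℕ-inject₁ t)))
                      (cong w (sym (NP.+-suc i₀ (toℕ t)))) (walk (i₀ + toℕ t))
    Z : SimpleCycle X
    Z = record { l = l ; vs = vs' ; es = es' ; closed = closed' ; vs-inj = vs-inj'
               ; es-inj = es-inj' ; joins = joins' }
    on-Z? : ∀ e → Dec (∃ λ t → es' t ≡ e)
    on-Z? e = FP.any? (λ t → es' t FP.≟ e)
    C : Subset m
    C = tabulate (λ e → does (on-Z? e))
    lookup-C : ∀ e → lookup C e ≡ does (on-Z? e)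
    lookup-C e = VP.lookup∘tabulate (λ e → does (on-Z? e)) e
    C-edges : EdgeSetOf X Z C
    C-edges e = (λ e∈C → dec-witness (on-Z? e) (trans (sym (lookup-C e)) (VP.[]=⇒lookup e∈C)))
              , (λ on-Z → VP.lookup⇒[]= e C (trans (lookup-C e) (dec-true (on-Z? e) on-Z)))
    C⊑D : C ⊑ D
    C⊑D e e∈C with dec-witness (on-Z? e) (trans (sym (lookup-C e)) e∈C)
    ... | (t , refl) = g∈D (i₀ + toℕ t)

  module WalkIn (D : Subset m) (even : Even D) where
    record Step : Set where
      constructor step
      field
        from to : Fin n
        edge    : Fin m
        edge∈D  : lookup D edge ≡ true
        joins   : Joins X edge from to

    continue : (s : Step) → Σ Step λ s' → Step.from s' ≡ Step.to s × Step.edge s' ≢ Step.edge s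
    continue (step u v e e∈D e-joins)
      with parity-other-one (λ x → lookup D x ∧ incident x v) e (even v)
                            (cong₂ _∧_ e∈D (dec-true (inc? e v) (joins⇒inc₂ e-joins)))
    ... | (b , b≢e , b-ok) with ∧-true _ _ b-ok
    ...   | (b∈D , b-inc) with inc⇒joins (dec-witness (inc? b v) b-inc)
    ...     | (v' , b-joins) = step v v' b b∈D b-joins , refl , b≢e

    module From (s₀ : Step) where
      walk : ℕ → Step
      walk zero = s₀
      walk (suc k) = proj₁ (continue (walk k))

      w : ℕ → Fin n
      w k = Step.from (walk k)

      g : ℕ → Fin m
      g k = Step.edge (walk k)

      g-joins : ∀ k → Joins X (g k) (w k) (w (suc k))
      g-joins k = subst (Joins X (g k) (w k)) (sym (proj₁ (proj₂ (continue (walk k)))))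
                        (Step.joins (walk k))

      Revisit : ℕ → Set
      Revisit j = Σ (Fin j) λ i → w (toℕ i) ≡ w j

      revisit? : ∀ j → Dec (Revisit j)
      revisit? j = FP.any? (λ i → w (toℕ i) FP.≟ w j)

      revisit : ∀ a b → a < b → w a ≡ w b → Revisit b
      revisit a b a<b eq = fromℕ< a<b , trans (cong w (FP.toℕ-fromℕ< a<b)) eq

      FirstRevisit : Set
      FirstRevisit = Σ ℕ λ j → Revisit j × (∀ j' → j' < j → ¬ Revisit j')

      search : ∀ k → (∀ j → j < k → ¬ Revisit j) ⊎ FirstRevisit
      search zero = inj₁ (λ j ())
      search (suc k) with search k
      ... | inj₂ first = inj₂ first
      ... | inj₁ none with revisit? k
      ...   | yes r = inj₂ (k , r , none)
      ...   | no ¬r = inj₁ none-up-to-k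
        where
        none-up-to-k : ∀ j → j < suc k → ¬ Revisit j
        none-up-to-k j j<1+k with NP.m<1+n⇒m<n∨m≡n j<1+k
        ... | inj₁ j<k = none j j<k
        ... | inj₂ refl = ¬r

      -- Among w₀ … w_n two vertices coincide, so a first revisit exists.
      first-revisit : FirstRevisit
      first-revisit with FP.pigeonhole (NP.n<1+n n) (λ (i : Fin (suc n)) → w (toℕ i))
      ... | (i , j , i<j , eq) with search (suc n)
      ...   | inj₂ first = first
      ...   | inj₁ none = ⊥-elim (none (toℕ j) (FP.toℕ<n j) (revisit (toℕ i) (toℕ j) i<j eq))

      -- Before the first revisit all vertices are distinct.
      circuit : ∃ λ C → IsCircuit X C × C ⊑ D
      circuit with first-revisit
      ... | (zero , (() , _) , _)
      ... | (suc j , (i , wi≡wj) , earlier) =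
        segment-circuit D w g g-joins (λ k → proj₂ (proj₂ (continue (walk k))))
                        (λ k → Step.edge∈D (walk k)) (toℕ i) l closes distinct
        where
        l : ℕ
        l = j ∸ toℕ i
        end≡ : toℕ i + suc l ≡ suc j
        end≡ = trans (NP.+-suc (toℕ i) l) (cong suc (NP.m+[n∸m]≡n (s≤s⁻¹ (FP.toℕ<n i))))
        closes : w (toℕ i + suc l) ≡ w (toℕ i)
        closes rewrite end≡ = sym wi≡wj
        distinct-before : ∀ a b → a < suc j → b < suc j → w a ≡ w b → a ≡ b
        distinct-before a b a< b< wa≡wb with NP.<-cmp a b
        ... | tri< a<b _ _ = ⊥-elim (earlier b b< (revisit a b a<b wa≡wb))
        ... | tri≈ _ a≡b _ = a≡b
        ... | tri> _ _ b<a = ⊥-elim (earlier a a< (revisit b a b<a (sym wa≡wb)))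
        distinct : ∀ a b → a < toℕ i + suc l → b < toℕ i + suc l → w a ≡ w b → a ≡ b
        distinct rewrite end≡ = distinct-before

  even-contains-circuit : ∀ D → Even D → ∀ e → lookup D e ≡ true → ∃ λ C → IsCircuit X C × C ⊑ D
  even-contains-circuit D even e e∈D =
    From.circuit (step (proj₁ (ends e)) (proj₂ (ends e)) e e∈D (inj₁ refl))
    where open WalkIn D even

  EvenOnCircuits : Permutation′ m → Set
  EvenOnCircuits ρ = ∀ C → IsCircuit X C → Even (image ρ C)

  image-even : (ρ : Permutation′ m) (A A' : Family m) → SpansCycles X A →
               (∀ C → A' C → IsCircuit X C) → (∀ a → A a → A' (image ρ a)) → EvenOnCircuits ρ
  image-even ρ A A' A-spans A'-circuits A→A' C cC =
    span-even A' A'-circuits (image ρ C) (image-span ρ A→A' C (A-spans C cC))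

  -- If ρ⁻¹ sends circuits to even sets, then ρ(C) equals every circuit D it
  -- contains: ρ⁻¹(D) ⊆ C is nonempty and even, so ρ⁻¹(D) = C.
  image-equals-inner-circuit : (ρ : Permutation′ m) → EvenOnCircuits (flip ρ) →
                               ∀ C D → IsCircuit X C → IsCircuit X D → D ⊑ image ρ C → image ρ C ≡ D
  image-equals-inner-circuit ρ ρ⁻¹-even C D cC cD D⊑ρC =
    ⊑-antisym (subst (image ρ C ⊑_) (image-image-flip ρ D)
                     (image-mono ρ {C} {image (flip ρ) D} C⊑ρ⁻¹D))
              D⊑ρC
    where
    ρ⁻¹D⊑C : image (flip ρ) D ⊑ C
    ρ⁻¹D⊑C = subst (image (flip ρ) D ⊑_) (image-flip-image ρ C)
                   (image-mono (flip ρ) {D} {image ρ C} D⊑ρC)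
    e : Fin m
    e = proj₁ (circuit-nonempty D cD)
    ρ⁻¹e∈ρ⁻¹D : lookup (image (flip ρ) D) (ρ ⟨$⟩ˡ e) ≡ true
    ρ⁻¹e∈ρ⁻¹D = trans (lookup-image-at (flip ρ) D e) (proj₂ (circuit-nonempty D cD))
    C⊑ρ⁻¹D : C ⊑ image (flip ρ) D
    C⊑ρ⁻¹D = circuit-minimal C (image (flip ρ) D) cC (ρ⁻¹-even D cD) ρ⁻¹D⊑C _ ρ⁻¹e∈ρ⁻¹D

  circuit-preserved : (ρ : Permutation′ m) → EvenOnCircuits ρ → EvenOnCircuits (flip ρ) →
                      ∀ C → IsCircuit X C → IsCircuit X (image ρ C)
  circuit-preserved ρ ρ-even ρ⁻¹-even C cC
    with circuit-nonempty C cC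
  ... | e , e∈C
    with even-contains-circuit (image ρ C) (ρ-even C cC) (ρ ⟨$⟩ʳ e)
                               (trans (lookup-image-at ρ C e) e∈C)
  ... | D , cD , D⊑ρC =
    subst (IsCircuit X) (sym (image-equals-inner-circuit ρ ρ⁻¹-even C D cC cD D⊑ρC)) cD

  even-preserving⇒aut : (π : Permutation′ m) →
                        EvenOnCircuits π → EvenOnCircuits (flip π) → InAut X π
  even-preserving⇒aut π π-even π⁻¹-even C =
      circuit-preserved π π-even π⁻¹-even C
    , λ cπC → subst (IsCircuit X) (image-flip-image π C)
                (circuit-preserved (flip π) π⁻¹-even π-even (image π C) cπC)

  module _ (π : Permutation′ m) (aut : InAut X π) (B : Family m) where

    aut-circuits : (∀ C → B C → IsCircuit X C) → ∀ D → imageFamily π B D → IsCircuit X D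
    aut-circuits B-circuits D (C , BC , refl) = proj₁ (aut C) (B-circuits C BC)

    -- A cycle D is π(π⁻¹ D), where π⁻¹ D is a cycle in span B.
    aut-spans : SpansCycles X B → SpansCycles X (imageFamily π B)
    aut-spans B-spans D cD = subst (InSpan (imageFamily π B)) (image-image-flip π D)
      (image-span π (image-member π B) (image (flip π) D)
        (B-spans _ (proj₂ (aut _) (subst (IsCircuit X) (sym (image-image-flip π D)) cD))))

    -- A spanning B' ⊆ π(B) pulls back to a spanning subfamily of B, which
    -- by minimality of B is all of B.
    aut-minimal : (∀ (B' : Family m) → (∀ C → B' C → B C) → SpansCycles X B' → ∀ C → B C → B' C) →
                  ∀ (B' : Family m) → (∀ C → B' C → imageFamily π B C) → SpansCycles X B' →
                  ∀ C → imageFamily π B C → B' C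
    aut-minimal B-minimal B' B'⊆πB B'-spans D (C , BC , refl) =
      B-minimal pullback pullback⊆B pullback-spans C BC
      where
      pullback : Family m
      pullback C = B' (image π C)
      pullback⊆B : ∀ C → pullback C → B C
      pullback⊆B C B'πC = subst B (image-flip-image π C) (preimage-member π B _ (B'⊆πB _ B'πC))
      pullback-spans : SpansCycles X pullback
      pullback-spans C cC = subst (InSpan pullback) (image-flip-image π C)
        (image-span (flip π) (λ a B'a → subst B' (sym (image-image-flip π a)) B'a) (image π C)
          (B'-spans (image π C) (proj₁ (aut C) cC)))

    aut-basis : IsCycleBasis X B → IsCycleBasis X (imageFamily π B)
    aut-basis (B-circuits , B-spans , B-minimal) =
      aut-circuits B-circuits , aut-spans B-spans , aut-minimal B-minimal

open CycleSpace using (image-even; even-preserving⇒aut; aut-basis)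

-- (⇒) is aut-basis.  (⇐): π maps B into π(B) and π⁻¹ maps π(B) into B, both
-- spanning families of circuits, so π and π⁻¹ send circuits to even sets.
lemma8 : ∀ {n m : ℕ} (X : Graph n m) (π : Permutation′ m) (B : Family m) →
         IsCycleBasis X B →
         (InAut X π → IsCycleBasis X (imageFamily π B))
         × (IsCycleBasis X (imageFamily π B) → InAut X π)
lemma8 X π B B-basis@(B-circuits , B-spans , _) =
    (λ aut → aut-basis X π aut B B-basis)
  , λ { (πB-circuits , πB-spans , _) →
        even-preserving⇒aut X π
          (image-even X π B (imageFamily π B) B-spans πB-circuits (image-member π B))
          (image-even X (flip π) (imageFamily π B) B πB-spans B-circuits (preimage-member π B)) }
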